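{- Consider any allocation process satisfying $\mathcal{W}_2$ and $\mathcal{P}_2$. Then for any $t\ge0$, \[ \mathbb{E}[\Upsilon^{t+1}\mid\mathfrak{F}^t]\le\Upsilon^t-(p_-^t w_- - p_+^t w_+)\Delta^t+4w_-^2. \] Moreover, for any process satisfying $\mathcal{P}_3$ and $\mathcal{W}_2$, or $\mathcal{P}_2$ and $\mathcal{W}_3$, there exist constants $c_1,c_2>0$ such that for any $t\ge0$, \[ \mathbb{E}[\Upsilon^{t+1}\mid\mathfrak{F}^t]\le\Upsilon^t-\frac{c_1}{n}\Delta^t+c_2. \]
   Context: There are $n$ bins; $x^t$ is the load vector after round $t$, $W^t=\sum_ix_i^t$, $y_i^t=x_i^t-W^t/n$, $\Delta^t=\sum_i|y_i^t|$, $\Upsilon^t=\sum_i(y_i^t)^2$. $B_+^t=\{i:y_i^t\ge0\}$, $B_-^t=[n]\setminus B_+^t$, $\delta^t=|B_+^t|/n$. In each round, with bins labeled so that $y_1^t\ge\dots\ge y_n^t$, a bin is chosen according to $p^t$ (possibly depending on the history $\mathfrak{F}^t$); $p_+^t=\max_{i\in B_+^t}p_i^t$, $p_-^t=\min_{i\in B_-^t}p_i^t$. $\mathcal{P}_2$: $p_+^t\le1/n\le p_-^t$. $\mathcal{P}_3$: $\mathcal{P}_2$ plus constants $k_1,k_2\in(0,1]$ with $p_+^t\le\frac1n-\frac{k_1(1-\delta^t)}n$, $p_-^t\ge\frac1n+\frac{k_2\delta^t}n$. $\mathcal{W}_2$: the chosen bin receives $w_-$ balls if underloaded, $w_+$ if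 overloaded, with constant integers $1\le w_+\le w_-$. $\mathcal{W}_3$: $\mathcal{W}_2$ with $w_+<w_-$ and $p_i^t$ non-decreasing in $i$.
   Formalization: The bin-choice distribution $p^t$ has rational entries, and the constants $k_1,k_2$ in $\mathcal{P}_3$ are rational. -}

module Defs where

open import Data.Nat as ℕ using (ℕ; NonZero)
open import Data.Integer as ℤ using (ℤ; +_)
open import Data.Rational using (ℚ; _+_; _*_; _-_; _≤_; _<_; _/_; _⊔_; _⊓_; ∣_∣; 0ℚ; 1ℚ)
open import Data.Fin using (Fin; _≟_)
open import Data.Fin.Permutation using (Permutation′; _⟨$⟩ʳ_)
open import Data.List using (List; foldr; map; filter)
open import Data.List.Base using (allFin)
open import Relation.Nullary using (Dec; yes; no; ¬_)
open import Data.Product using (_×_; ∃)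
import Data.Rational.Properties as ℚP

Σ : ∀ {n} → (Fin n → ℚ) → ℚ
Σ {n} f = foldr _+_ 0ℚ (map f (allFin n))

ℕtoℚ : ℕ → ℚ
ℕtoℚ k = (+ k) / 1

module _ {n : ℕ} .{{_ : NonZero n}} where

  W : (Fin n → ℕ) → ℕ
  W x = Data.List.foldr ℕ._+_ 0 (map x (allFin n))

  y : (Fin n → ℕ) → Fin n → ℚ
  y x i = ℕtoℚ (x i) - ((+ W x) / n)

  Δ : (Fin n → ℕ) → ℚ
  Δ x = Σ (λ i → ∣ y x i ∣)

  Υ : (Fin n → ℕ) → ℚ
  Υ x = Σ (λ i → y x i * y x i)

  Over : (Fin n → ℕ) → Fin n → Set
  Over x i = 0ℚ ≤ y x i

  δ : (Fin n → ℕ) → ℚ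
  δ x = (+ Data.List.length (filter (λ i → 0ℚ ℚP.≤? y x i) (allFin n))) / n

  -- p₊ = max over B₊ of p_i  (B₊ is always nonempty; p ≥ 0, so start value 0 is harmless)
  pPlus : (Fin n → ℕ) → (Fin n → ℚ) → ℚ
  pPlus x p = foldr _⊔_ 0ℚ (map p (filter (λ i → 0ℚ ℚP.≤? y x i) (allFin n)))

  -- p₋ = min over B₋ of p_i  (if B₋ = ∅ this gives 1; then Δ = 0 so it never matters)
  pMinus : (Fin n → ℕ) → (Fin n → ℚ) → ℚ
  pMinus x p = foldr _⊓_ 1ℚ (map p (filter (λ i → y x i ℚP.<? 0ℚ) (allFin n)))

  IsProb : (Fin n → ℚ) → Set
  IsProb p = (∀ i → 0ℚ ≤ p i) × Σ p ≡ 1ℚ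
    where open import Relation.Binary.PropositionalEquality using (_≡_)

  -- condition P₂ : p₊ ≤ 1/n ≤ p₋ (unfolded: every overloaded bin has p_i ≤ 1/n,
  -- every underloaded bin has p_i ≥ 1/n)
  P₂ : (Fin n → ℕ) → (Fin n → ℚ) → Set
  P₂ x p = (∀ i → 0ℚ ≤ y x i → p i ≤ (+ 1) / n)
         × (∀ i → y x i < 0ℚ → (+ 1) / n ≤ p i)

  P₃ : ℚ → ℚ → (Fin n → ℕ) → (Fin n → ℚ) → Set
  P₃ k₁ k₂ x p = P₂ x p
         × (∀ i → 0ℚ ≤ y x i → p i ≤ ((+ 1) / n) - (k₁ * (1ℚ - δ x)) * ((+ 1) / n))
         × (∀ i → y x i < 0ℚ → ((+ 1) / n) + (k₂ * δ x) * ((+ 1) / n) ≤ p i)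

  -- monotonicity part of W₃: with bins labelled so that y is non-increasing,
  -- p is non-decreasing in the label; a labelling is a permutation σ (label j ↦ bin σ j)
  SortedMonotone : (Fin n → ℕ) → (Fin n → ℚ) → Set
  SortedMonotone x p = ∃ λ (σ : Permutation′ n) →
      (∀ j k → Data.Fin._≤_ j k → y x (σ ⟨$⟩ʳ k) ≤ y x (σ ⟨$⟩ʳ j))
    × (∀ j k → Data.Fin._≤_ j k → p (σ ⟨$⟩ʳ j) ≤ p (σ ⟨$⟩ʳ k))

  weight : ℕ → ℕ → (Fin n → ℕ) → Fin n → ℕ
  weight w₊ w₋ x i with 0ℚ ℚP.≤? y x i
  ... | yes _ = w₊
  ... | no _  = w₋

  step : ℕ → ℕ → (Fin n → ℕ) → Fin n → (Fin n → ℕ)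
  step w₊ w₋ x i j with i ≟ j
  ... | yes _ = x j ℕ.+ weight w₊ w₋ x i
  ... | no _  = x j

  -- E[Υ^{t+1} | 𝔉^t] when the current load vector is x and the bin is sampled from p
  EΥnext : ℕ → ℕ → (Fin n → ℕ) → (Fin n → ℚ) → ℚ
  EΥnext w₊ w₋ x p = Σ (λ i → p i * Υ (step w₊ w₋ x i))

{-# OPTIONS --safe #-}
-- When the chosen bin i receives ω balls the average load rises by ω/n, so every y_j drops
-- by ω/n and y_i rises by ω. As Σ y_j = 0 and n · (1/n) = 1, Υ changes by exactly
-- 2ω y_i + ω²(1 − 1/n), and the quadratic part is at most w₋². Again because Σ y_j = 0, the
-- overloaded and the underloaded bins each carry Δ/2 of Σ |y_j|, so the expected linear part
-- Σ 2 p_i ω_i y_i is at most (A − B) Δ as soon as p_i ω_i ≤ A on overloaded bins and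
-- p_i ω_i ≥ B on underloaded ones. The three statements take (A, B) to be (p₊w₊, p₋w₋), the
-- bounds of P₃ times the weights, and (w₊/n, w₋/n) from P₂; in the last two B − A ≥ c₁/n.

module Submission where

open import Level using (0ℓ)
open import Function using (_∘_; id)
open import Data.Nat as ℕ using (ℕ; NonZero; zero; suc)
import Data.Nat.Properties as ℕP
open import Data.Integer as ℤ using (+_)
import Data.Integer.Properties as ℤP
open import Data.Rational
  using ( ℚ; _+_; _*_; _-_; -_; _≤_; _<_; _/_; _⊔_; _⊓_; ∣_∣; 0ℚ; 1ℚ; toℚᵘ
        ; nonNegative; nonPositive; positive)
import Data.Rational.Properties as ℚP
import Data.Rational.Unnormalised as ℚᵘ
import Data.Rational.Unnormalised.Properties as ℚᵘP
open import Data.Fin as F using (Fin; punchIn)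
import Data.Fin.Properties as FP
open import Data.List as List using (List; []; _∷_; foldr; map; filter; allFin)
import Data.List.Properties as LP
open import Data.List.Membership.Propositional using (_∈_)
open import Data.List.Membership.Propositional.Properties using (∈-filter⁺; ∈-allFin)
open import Data.List.Relation.Unary.Any using (here; there)
open import Data.Product using (_×_; _,_; ∃₂)
open import Tactic.RingSolver using (solve-∀)
import Tactic.RingSolver.Core.AlmostCommutativeRing as ACR
open import Relation.Binary.PropositionalEquality
open import Relation.Nullary using (yes; no; contradiction)
open import Relation.Nullary.Decidable using (dec⇒maybe)
open import Algebra.Bundles using (CommutativeRing)
open import Algebra.Properties.Semiring.Sum (CommutativeRing.semiring ℚP.+-*-commutativeRing)
  using (sum; sum-cong-≗; ∑-distrib-+; *-distribˡ-sum; *-distribʳ-sum; sum-remove)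
open import Defs

ℚ-ring : ACR.AlmostCommutativeRing 0ℓ 0ℓ
ℚ-ring = ACR.fromCommutativeRing ℚP.+-*-commutativeRing (λ p → dec⇒maybe (0ℚ ℚP.≟ p))

toℚᵘ-/ : ∀ i n .{{_ : NonZero n}} → toℚᵘ (i / n) ℚᵘ.≃ i ℚᵘ./ n
toℚᵘ-/ i (suc m) = ℚP.toℚᵘ-fromℚᵘ (ℚᵘ.mkℚᵘ i m)

ℕtoℚ-homo-+ : ∀ a b → ℕtoℚ (a ℕ.+ b) ≡ ℕtoℚ a + ℕtoℚ b
ℕtoℚ-homo-+ a b = ℚP.toℚᵘ-injective (begin
  toℚᵘ (ℕtoℚ (a ℕ.+ b))             ≈⟨ toℚᵘ-/ (+ (a ℕ.+ b)) 1 ⟩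
  + (a ℕ.+ b) ℚᵘ./ 1                ≈⟨ ℚᵘ.*≡* (cong (ℤ._* + 1) +[a+b]≡+a*1++b*1) ⟩
  (+ a ℚᵘ./ 1) ℚᵘ.+ (+ b ℚᵘ./ 1)    ≈⟨ ℚᵘP.+-cong (toℚᵘ-/ (+ a) 1) (toℚᵘ-/ (+ b) 1) ⟨
  toℚᵘ (ℕtoℚ a) ℚᵘ.+ toℚᵘ (ℕtoℚ b)  ≈⟨ ℚP.toℚᵘ-homo-+ (ℕtoℚ a) (ℕtoℚ b) ⟨
  toℚᵘ (ℕtoℚ a + ℕtoℚ b)            ∎)
  where
  open ℚᵘP.≃-Reasoning
  +[a+b]≡+a*1++b*1 : + (a ℕ.+ b) ≡ + a ℤ.* + 1 ℤ.+ + b ℤ.* + 1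
  +[a+b]≡+a*1++b*1 =
    trans (ℤP.pos-+ a b) (sym (cong₂ ℤ._+_ (ℤP.*-identityʳ (+ a)) (ℤP.*-identityʳ (+ b))))

ℕtoℚ-homo-* : ∀ a b → ℕtoℚ (a ℕ.* b) ≡ ℕtoℚ a * ℕtoℚ b
ℕtoℚ-homo-* a b = ℚP.toℚᵘ-injective (begin
  toℚᵘ (ℕtoℚ (a ℕ.* b))             ≈⟨ toℚᵘ-/ (+ (a ℕ.* b)) 1 ⟩
  + (a ℕ.* b) ℚᵘ./ 1                ≈⟨ ℚᵘ.*≡* (cong (ℤ._* + 1) (ℤP.pos-* a b)) ⟩
  (+ a ℚᵘ./ 1) ℚᵘ.* (+ b ℚᵘ./ 1)    ≈⟨ ℚᵘP.*-cong (toℚᵘ-/ (+ a) 1) (toℚᵘ-/ (+ b) 1) ⟨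
  toℚᵘ (ℕtoℚ a) ℚᵘ.* toℚᵘ (ℕtoℚ b)  ≈⟨ ℚP.toℚᵘ-homo-* (ℕtoℚ a) (ℕtoℚ b) ⟨
  toℚᵘ (ℕtoℚ a * ℕtoℚ b)            ∎)
  where open ℚᵘP.≃-Reasoning

a/n≡a*[1/n] : ∀ a n .{{_ : NonZero n}} → (+ a) / n ≡ ℕtoℚ a * ((+ 1) / n)
a/n≡a*[1/n] a n@(suc m) = ℚP.toℚᵘ-injective (begin
  toℚᵘ ((+ a) / n)                        ≈⟨ toℚᵘ-/ (+ a) n ⟩
  + a ℚᵘ./ n                              ≈⟨ ℚᵘ.*≡* (cong₂ ℤ._*_ (sym (ℤP.*-identityʳ (+ a)))
                                                                (cong +_ (ℕP.*-identityˡ n))) ⟩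
  (+ a ℚᵘ./ 1) ℚᵘ.* (+ 1 ℚᵘ./ n)          ≈⟨ ℚᵘP.*-cong (toℚᵘ-/ (+ a) 1) (toℚᵘ-/ (+ 1) n) ⟨
  toℚᵘ (ℕtoℚ a) ℚᵘ.* toℚᵘ ((+ 1) / n)     ≈⟨ ℚP.toℚᵘ-homo-* (ℕtoℚ a) ((+ 1) / n) ⟨
  toℚᵘ (ℕtoℚ a * ((+ 1) / n))             ∎)
  where open ℚᵘP.≃-Reasoning

n*[1/n]≡1 : ∀ n .{{_ : NonZero n}} → ℕtoℚ n * ((+ 1) / n) ≡ 1ℚ
n*[1/n]≡1 n@(suc _) = trans (sym (a/n≡a*[1/n] n n)) (ℚP.toℚᵘ-injective (begin
  toℚᵘ ((+ n) / n)  ≈⟨ toℚᵘ-/ (+ n) n ⟩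
  + n ℚᵘ./ n        ≈⟨ ℚᵘ.*≡* (ℤP.*-comm (+ n) (+ 1)) ⟩
  toℚᵘ 1ℚ           ∎))
  where open ℚᵘP.≃-Reasoning

0≤a/n : ∀ a n .{{_ : NonZero n}} → 0ℚ ≤ (+ a) / n
0≤a/n a n = ℚP.nonNegative⁻¹ _ {{ℚP.normalize-nonNeg a n}}

0≤ℕtoℚ : ∀ a → 0ℚ ≤ ℕtoℚ a
0≤ℕtoℚ a = 0≤a/n a 1

ℕtoℚ-mono-≤ : ∀ {a b} → a ℕ.≤ b → ℕtoℚ a ≤ ℕtoℚ b
ℕtoℚ-mono-≤ {a} {b} a≤b = begin
  ℕtoℚ a                 ≡⟨ ℚP.+-identityʳ (ℕtoℚ a) ⟨
  ℕtoℚ a + 0ℚ            ≤⟨ ℚP.+-monoʳ-≤ (ℕtoℚ a) (0≤ℕtoℚ (b ℕ.∸ a)) ⟩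
  ℕtoℚ a + ℕtoℚ (b ℕ.∸ a) ≡⟨ ℕtoℚ-homo-+ a (b ℕ.∸ a) ⟨
  ℕtoℚ (a ℕ.+ (b ℕ.∸ a)) ≡⟨ cong ℕtoℚ (ℕP.m+[n∸m]≡n a≤b) ⟩
  ℕtoℚ b                 ∎
  where open ℚP.≤-Reasoning

0<1 : 0ℚ < 1ℚ
0<1 = ℚP.positive⁻¹ 1ℚ

0≤q-p⇒p≤q : ∀ {p q} → 0ℚ ≤ q - p → p ≤ q
0≤q-p⇒p≤q {p} {q} 0≤q-p = begin
  p             ≡⟨ ℚP.+-identityʳ p ⟨
  p + 0ℚ        ≤⟨ ℚP.+-monoʳ-≤ p 0≤q-p ⟩
  p + (q - p)   ≡⟨ p+[q-p]≡q p q ⟩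
  q             ∎
  where
  open ℚP.≤-Reasoning
  p+[q-p]≡q : ∀ p q → p + (q - p) ≡ q
  p+[q-p]≡q = solve-∀ ℚ-ring

p≤q⇒0≤q-p : ∀ {p q} → p ≤ q → 0ℚ ≤ q - p
p≤q⇒0≤q-p {p} {q} p≤q = subst (_≤ q - p) (ℚP.+-inverseʳ p) (ℚP.+-monoˡ-≤ (- p) p≤q)

+-pres-0≤ : ∀ {p q} → 0ℚ ≤ p → 0ℚ ≤ q → 0ℚ ≤ p + q
+-pres-0≤ = ℚP.+-mono-≤

*-pres-0≤ : ∀ {p q} → 0ℚ ≤ p → 0ℚ ≤ q → 0ℚ ≤ p * q
*-pres-0≤ {p} {q} 0≤p 0≤q = ℚP.nonNegative⁻¹ _
  {{ℚP.nonNeg*nonNeg⇒nonNeg p {{nonNegative 0≤p}} q {{nonNegative 0≤q}}}}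

*-monoʳ-≤-0≤ : ∀ {r p q} → 0ℚ ≤ r → p ≤ q → p * r ≤ q * r
*-monoʳ-≤-0≤ {r} 0≤r = ℚP.*-monoʳ-≤-nonNeg r {{nonNegative 0≤r}}

a/n≤1 : ∀ {a} n .{{_ : NonZero n}} → a ℕ.≤ n → (+ a) / n ≤ 1ℚ
a/n≤1 {a} n a≤n = begin
  (+ a) / n               ≡⟨ a/n≡a*[1/n] a n ⟩
  ℕtoℚ a * ((+ 1) / n)    ≤⟨ *-monoʳ-≤-0≤ (0≤a/n 1 n) (ℕtoℚ-mono-≤ a≤n) ⟩
  ℕtoℚ n * ((+ 1) / n)    ≡⟨ n*[1/n]≡1 n ⟩
  1ℚ                      ∎
  where open ℚP.≤-Reasoning

-- For v ≥ 0 the right-hand side is 2Av, for v < 0 it is 2Bv.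
[q+q]*v≤[A+B]*v+[A-B]*∣v∣ : ∀ {q v A B} → (0ℚ ≤ v → q ≤ A) → (v < 0ℚ → B ≤ q) →
                            (q + q) * v ≤ (A + B) * v + (A - B) * ∣ v ∣
[q+q]*v≤[A+B]*v+[A-B]*∣v∣ {q} {v} {A} {B} q≤A B≤q with 0ℚ ℚP.≤? v
... | yes 0≤v = begin
  (q + q) * v                    ≤⟨ *-monoʳ-≤-0≤ 0≤v (ℚP.+-mono-≤ (q≤A 0≤v) (q≤A 0≤v)) ⟩
  (A + A) * v                    ≡⟨ [A+A]*v≡[A+B]*v+[A-B]*v A B v ⟩
  (A + B) * v + (A - B) * v      ≡⟨ cong (λ t → (A + B) * v + (A - B) * t) (ℚP.0≤p⇒∣p∣≡p 0≤v) ⟨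
  (A + B) * v + (A - B) * ∣ v ∣  ∎
  where
  open ℚP.≤-Reasoning
  [A+A]*v≡[A+B]*v+[A-B]*v : ∀ A B v → (A + A) * v ≡ (A + B) * v + (A - B) * v
  [A+A]*v≡[A+B]*v+[A-B]*v = solve-∀ ℚ-ring
... | no 0≰v = begin
  (q + q) * v                    ≤⟨ ℚP.*-monoʳ-≤-nonPos v {{nonPositive v≤0}} 2B≤2q ⟩
  (B + B) * v                    ≡⟨ [B+B]*v≡[A+B]*v+[A-B]*-v A B v ⟩
  (A + B) * v + (A - B) * - v    ≡⟨ cong (λ t → (A + B) * v + (A - B) * t) ∣v∣≡-v ⟨
  (A + B) * v + (A - B) * ∣ v ∣  ∎
  where
  open ℚP.≤-Reasoning
  v<0 = ℚP.≰⇒> 0≰v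
  v≤0 = ℚP.<⇒≤ v<0
  2B≤2q = ℚP.+-mono-≤ (B≤q v<0) (B≤q v<0)
  ∣v∣≡-v : ∣ v ∣ ≡ - v
  ∣v∣≡-v = trans (sym (ℚP.∣-p∣≡∣p∣ v)) (ℚP.0≤p⇒∣p∣≡p (ℚP.neg-antimono-≤ v≤0))
  [B+B]*v≡[A+B]*v+[A-B]*-v : ∀ A B v → (B + B) * v ≡ (A + B) * v + (A - B) * - v
  [B+B]*v≡[A+B]*v+[A-B]*-v = solve-∀ ℚ-ring

a*a*[1-u]≤b*b : ∀ {a b u} → 0ℚ ≤ a → a ≤ b → 0ℚ ≤ u → a * a * (1ℚ - u) ≤ b * b
a*a*[1-u]≤b*b {a} {b} {u} 0≤a a≤b 0≤u = begin
  a * a * (1ℚ - u)        ≡⟨ distrib a u ⟩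
  a * a + - (a * a * u)   ≤⟨ ℚP.+-monoʳ-≤ (a * a) (ℚP.neg-antimono-≤ (*-pres-0≤ (*-pres-0≤ 0≤a 0≤a) 0≤u)) ⟩
  a * a + 0ℚ              ≡⟨ ℚP.+-identityʳ (a * a) ⟩
  a * a                   ≤⟨ ℚP.*-monoˡ-≤-nonNeg a {{nonNegative 0≤a}} a≤b ⟩
  a * b                   ≤⟨ *-monoʳ-≤-0≤ (ℚP.≤-trans 0≤a a≤b) a≤b ⟩
  b * b                   ∎
  where
  open ℚP.≤-Reasoning
  distrib : ∀ a u → a * a * (1ℚ - u) ≡ a * a + - (a * a * u)
  distrib = solve-∀ ℚ-ring

drift-weaken : ∀ {c d D} U K → c ≤ d → 0ℚ ≤ D → (U - d * D) + K ≤ (U - c * D) + K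
drift-weaken U K c≤d 0≤D = ℚP.+-monoˡ-≤ K (ℚP.+-monoʳ-≤ U (ℚP.neg-antimono-≤ (*-monoʳ-≤-0≤ 0≤D c≤d)))

P₃-gap : ∀ {u δ k₁ k₂ a b} → 0ℚ ≤ u → 0ℚ ≤ δ → δ ≤ 1ℚ → 0ℚ ≤ k₁ → k₁ ≤ 1ℚ → 0ℚ ≤ k₂ → k₂ ≤ 1ℚ →
  1ℚ ≤ a → a ≤ b → (k₁ * k₂) * u ≤ (u + (k₂ * δ) * u) * b - (u - (k₁ * (1ℚ - δ)) * u) * a
P₃-gap {u} {δ} {k₁} {k₂} {a} {b} 0≤u 0≤δ δ≤1 0≤k₁ k₁≤1 0≤k₂ k₂≤1 1≤a a≤b =
  0≤q-p⇒p≤q (subst (0ℚ ≤_) (sym (gap≡ u δ k₁ k₂ a b))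
    (*-pres-0≤ 0≤u (+-pres-0≤ (+-pres-0≤ (+-pres-0≤
      (*-pres-0≤ (p≤q⇒0≤q-p a≤b) (+-pres-0≤ (ℚP.<⇒≤ 0<1) (*-pres-0≤ 0≤k₂ 0≤δ)))
      (*-pres-0≤ (*-pres-0≤ 0≤a (*-pres-0≤ 0≤k₂ (p≤q⇒0≤q-p k₁≤1))) 0≤δ))
      (*-pres-0≤ (*-pres-0≤ 0≤a (*-pres-0≤ 0≤k₁ (p≤q⇒0≤q-p k₂≤1))) (p≤q⇒0≤q-p δ≤1)))
      (*-pres-0≤ (p≤q⇒0≤q-p 1≤a) (*-pres-0≤ 0≤k₁ 0≤k₂)))))
  where
  0≤a = ℚP.≤-trans (ℚP.<⇒≤ 0<1) 1≤a
  gap≡ : ∀ u δ k₁ k₂ a b →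
    ((u + (k₂ * δ) * u) * b - (u - (k₁ * (1ℚ - δ)) * u) * a) - (k₁ * k₂) * u
      ≡ u * ((b - a) * (1ℚ + k₂ * δ) + a * (k₂ * (1ℚ - k₁)) * δ
             + a * (k₁ * (1ℚ - k₂)) * (1ℚ - δ) + (a - 1ℚ) * (k₁ * k₂))
  gap≡ = solve-∀ ℚ-ring

W₃-gap : ∀ {u a b} → 0ℚ ≤ u → 1ℚ + a ≤ b → 1ℚ * u ≤ u * b - u * a
W₃-gap {u} {a} {b} 0≤u 1+a≤b =
  0≤q-p⇒p≤q (subst (0ℚ ≤_) (sym (gap≡ u a b)) (*-pres-0≤ 0≤u (p≤q⇒0≤q-p 1+a≤b)))
  where
  gap≡ : ∀ u a b → (u * b - u * a) - 1ℚ * u ≡ u * (b - (1ℚ + a))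
  gap≡ = solve-∀ ℚ-ring

foldr-⊔-ub : ∀ {A : Set} (f : A → ℚ) z {a} {as : List A} → a ∈ as → f a ≤ foldr _⊔_ z (map f as)
foldr-⊔-ub f z (here refl) = ℚP.p≤p⊔q (f _) _
foldr-⊔-ub f z {as = b ∷ _} (there a∈as) = ℚP.≤-trans (foldr-⊔-ub f z a∈as) (ℚP.p≤q⊔p (f b) _)

foldr-⊓-lb : ∀ {A : Set} (f : A → ℚ) z {a} {as : List A} → a ∈ as → foldr _⊓_ z (map f as) ≤ f a
foldr-⊓-lb f z (here refl) = ℚP.p⊓q≤p (f _) _
foldr-⊓-lb f z {as = b ∷ _} (there a∈as) = ℚP.≤-trans (ℚP.p⊓q≤q (f b) _) (foldr-⊓-lb f z a∈as)

Σ≡sum : ∀ {n} (f : Fin n → ℚ) → Σ f ≡ sum f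
Σ≡sum {n} f = trans (cong (foldr _+_ 0ℚ) (LP.map-tabulate id f)) (foldr-tabulate f)
  where
  foldr-tabulate : ∀ {m} (g : Fin m → ℚ) → foldr _+_ 0ℚ (List.tabulate g) ≡ sum g
  foldr-tabulate {zero}  g = refl
  foldr-tabulate {suc m} g = cong (_+_ (g F.zero)) (foldr-tabulate (g ∘ F.suc))

ℕtoℚ-foldr-+ : ∀ (as : List ℕ) → ℕtoℚ (foldr ℕ._+_ 0 as) ≡ foldr _+_ 0ℚ (map ℕtoℚ as)
ℕtoℚ-foldr-+ []       = refl
ℕtoℚ-foldr-+ (a ∷ as) = trans (ℕtoℚ-homo-+ a _) (cong (_+_ (ℕtoℚ a)) (ℕtoℚ-foldr-+ as))

sum-const : ∀ {n} c → sum {n} (λ _ → c) ≡ ℕtoℚ n * c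
sum-const {zero}  c = sym (ℚP.*-zeroˡ c)
sum-const {suc n} c = begin
  c + sum {n} (λ _ → c)     ≡⟨ cong (_+_ c) (sum-const {n} c) ⟩
  c + ℕtoℚ n * c            ≡⟨ c+N*c≡[1+N]*c c (ℕtoℚ n) ⟩
  (1ℚ + ℕtoℚ n) * c         ≡⟨ cong (_* c) (ℕtoℚ-homo-+ 1 n) ⟨
  ℕtoℚ (suc n) * c          ∎
  where
  open ≡-Reasoning
  c+N*c≡[1+N]*c : ∀ c N → c + N * c ≡ (1ℚ + N) * c
  c+N*c≡[1+N]*c = solve-∀ ℚ-ring

sum-mono-≤ : ∀ {n} {f g : Fin n → ℚ} → (∀ i → f i ≤ g i) → sum f ≤ sum g
sum-mono-≤ {zero}  f≤g = ℚP.≤-refl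
sum-mono-≤ {suc n} f≤g = ℚP.+-mono-≤ (f≤g F.zero) (sum-mono-≤ (f≤g ∘ F.suc))

sum-pres-0≤ : ∀ {n} {f : Fin n → ℚ} → (∀ i → 0ℚ ≤ f i) → 0ℚ ≤ sum f
sum-pres-0≤ {zero}  0≤f = ℚP.≤-refl
sum-pres-0≤ {suc n} 0≤f = +-pres-0≤ (0≤f F.zero) (sum-pres-0≤ (0≤f ∘ F.suc))

sum-update : ∀ {n} {f g : Fin n → ℚ} i → (∀ j → j ≢ i → f j ≡ g j) → sum f ≡ (sum g - g i) + f i
sum-update {suc n} {f} {g} i f≡g = begin
  sum f                                      ≡⟨ sum-remove f ⟩
  f i + sum (f ∘ punchIn i)                  ≡⟨ cong (_+_ (f i)) (sum-cong-≗ f≗g-off-i) ⟩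
  f i + sum (g ∘ punchIn i)                  ≡⟨ a+s≡[[b+s]-b]+a (f i) (g i) _ ⟩
  ((g i + sum (g ∘ punchIn i)) - g i) + f i  ≡⟨ cong (λ s → (s - g i) + f i) (sum-remove g) ⟨
  (sum g - g i) + f i                        ∎
  where
  open ≡-Reasoning
  f≗g-off-i : ∀ j → f (punchIn i j) ≡ g (punchIn i j)
  f≗g-off-i j = f≡g (punchIn i j) (FP.punchInᵢ≢i i j)
  a+s≡[[b+s]-b]+a : ∀ a b s → a + s ≡ ((b + s) - b) + a
  a+s≡[[b+s]-b]+a = solve-∀ ℚ-ring

sum-[q+q]*v≤[A-B]*sum∣v∣ : ∀ {n} (q v : Fin n → ℚ) {A B} → sum v ≡ 0ℚ →
  (∀ j → 0ℚ ≤ v j → q j ≤ A) → (∀ j → v j < 0ℚ → B ≤ q j) →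
  sum (λ j → (q j + q j) * v j) ≤ (A - B) * sum (λ j → ∣ v j ∣)
sum-[q+q]*v≤[A-B]*sum∣v∣ q v {A} {B} Σv≡0 q≤A B≤q = begin
  sum (λ j → (q j + q j) * v j)
    ≤⟨ sum-mono-≤ (λ j → [q+q]*v≤[A+B]*v+[A-B]*∣v∣ (q≤A j) (B≤q j)) ⟩
  sum (λ j → (A + B) * v j + (A - B) * ∣ v j ∣)
    ≡⟨ ∑-distrib-+ (λ j → (A + B) * v j) (λ j → (A - B) * ∣ v j ∣) ⟩
  sum (λ j → (A + B) * v j) + sum (λ j → (A - B) * ∣ v j ∣)
    ≡⟨ cong₂ _+_ (*-distribˡ-sum (A + B) v) (*-distribˡ-sum (A - B) ∣v∣) ⟨
  (A + B) * sum v + (A - B) * sum ∣v∣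
    ≡⟨ cong (λ s → (A + B) * s + (A - B) * sum ∣v∣) Σv≡0 ⟩
  (A + B) * 0ℚ + (A - B) * sum ∣v∣
    ≡⟨ drop-zero-term (A + B) ((A - B) * sum ∣v∣) ⟩
  (A - B) * sum ∣v∣
    ∎
  where
  open ℚP.≤-Reasoning
  ∣v∣ : Fin _ → ℚ
  ∣v∣ j = ∣ v j ∣
  drop-zero-term : ∀ a s → a * 0ℚ + s ≡ s
  drop-zero-term = solve-∀ ℚ-ring

weighted-average-≤ : ∀ {n} (p r : Fin n → ℚ) {K} → (∀ i → 0ℚ ≤ p i) → sum p ≡ 1ℚ →
                     (∀ i → r i ≤ K) → sum (λ i → p i * r i) ≤ K
weighted-average-≤ p r {K} 0≤p Σp≡1 r≤K = begin
  sum (λ i → p i * r i)   ≤⟨ sum-mono-≤ (λ i → ℚP.*-monoˡ-≤-nonNeg (p i) {{nonNegative (0≤p i)}} (r≤K i)) ⟩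
  sum (λ i → p i * K)     ≡⟨ *-distribʳ-sum K p ⟨
  sum p * K               ≡⟨ cong (_* K) Σp≡1 ⟩
  1ℚ * K                  ≡⟨ ℚP.*-identityˡ K ⟩
  K                       ∎
  where open ℚP.≤-Reasoning

sumSq : ∀ {n} → (Fin n → ℚ) → ℚ
sumSq v = sum (λ j → v j * v j)

sumSq-shift : ∀ {n} (v : Fin n → ℚ) c → sum v ≡ 0ℚ →
              sumSq (λ j → v j - c) ≡ sumSq v + ℕtoℚ n * (c * c)
sumSq-shift {n} v c Σv≡0 = begin
  sum (λ j → (v j - c) * (v j - c))
    ≡⟨ sum-cong-≗ (λ j → square-expand (v j) c) ⟩
  sum (λ j → v j * v j + (- (c + c) * v j + c * c))
    ≡⟨ ∑-distrib-+ (λ j → v j * v j) _ ⟩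
  sumSq v + sum (λ j → - (c + c) * v j + c * c)
    ≡⟨ cong (_+_ (sumSq v)) (∑-distrib-+ (λ j → - (c + c) * v j) _) ⟩
  sumSq v + (sum (λ j → - (c + c) * v j) + sum {n} (λ _ → c * c))
    ≡⟨ cong (_+_ (sumSq v)) (cong₂ _+_ (*-distribˡ-sum (- (c + c)) v) (sym (sum-const {n} (c * c)))) ⟨
  sumSq v + (- (c + c) * sum v + ℕtoℚ n * (c * c))
    ≡⟨ cong (λ s → sumSq v + (- (c + c) * s + ℕtoℚ n * (c * c))) Σv≡0 ⟩
  sumSq v + (- (c + c) * 0ℚ + ℕtoℚ n * (c * c))
    ≡⟨ drop-zero-term (sumSq v) c (ℕtoℚ n) ⟩
  sumSq v + ℕtoℚ n * (c * c)
    ∎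
  where
  open ≡-Reasoning
  square-expand : ∀ a c → (a - c) * (a - c) ≡ a * a + (- (c + c) * a + c * c)
  square-expand = solve-∀ ℚ-ring
  drop-zero-term : ∀ s c N → s + (- (c + c) * 0ℚ + N * (c * c)) ≡ s + N * (c * c)
  drop-zero-term = solve-∀ ℚ-ring

module _ {n : ℕ} .{{_ : NonZero n}} where

  mean : (Fin n → ℚ) → ℚ
  mean f = sum f * ((+ 1) / n)

  dev : (Fin n → ℚ) → Fin n → ℚ
  dev f j = f j - mean f

  sum-dev≡0 : (f : Fin n → ℚ) → sum (dev f) ≡ 0ℚ
  sum-dev≡0 f = begin
    sum (λ j → f j + - mean f)             ≡⟨ ∑-distrib-+ f (λ _ → - mean f) ⟩
    sum f + sum {n} (λ _ → - mean f)       ≡⟨ cong (_+_ (sum f)) (sum-const {n} (- mean f)) ⟩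
    sum f + ℕtoℚ n * - (sum f * (+ 1 / n)) ≡⟨ s+N*-[s*u]≡s*[1-N*u] (sum f) (ℕtoℚ n) ((+ 1) / n) ⟩
    sum f * (1ℚ - ℕtoℚ n * (+ 1 / n))      ≡⟨ cong (λ t → sum f * (1ℚ - t)) (n*[1/n]≡1 n) ⟩
    sum f * (1ℚ - 1ℚ)                      ≡⟨ s*[1-1]≡0 (sum f) ⟩
    0ℚ                                     ∎
    where
    open ≡-Reasoning
    s+N*-[s*u]≡s*[1-N*u] : ∀ s N u → s + N * - (s * u) ≡ s * (1ℚ - N * u)
    s+N*-[s*u]≡s*[1-N*u] = solve-∀ ℚ-ring
    s*[1-1]≡0 : ∀ s → s * (1ℚ - 1ℚ) ≡ 0ℚ
    s*[1-1]≡0 = solve-∀ ℚ-ring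

  sumSq-dev-increment : ∀ (f f′ : Fin n → ℚ) i k → (∀ j → j ≢ i → f′ j ≡ f j) → f′ i ≡ f i + k →
    sumSq (dev f′) ≡ sumSq (dev f) + (k + k) * dev f i + k * k * (1ℚ - (+ 1) / n)
  sumSq-dev-increment f f′ i k f′≡f f′i≡fi+k = begin
    sumSq (dev f′)
      ≡⟨ sum-update i (λ j j≢i → cong (λ t → t * t) (dev-other j j≢i)) ⟩
    (sumSq (λ j → v j - c) - (v i - c) * (v i - c)) + dev f′ i * dev f′ i
      ≡⟨ cong₂ (λ s t → (s - (v i - c) * (v i - c)) + t * t) (sumSq-shift v c (sum-dev≡0 f)) dev-self ⟩
    ((sumSq v + ℕtoℚ n * (c * c)) - (v i - c) * (v i - c)) + ((v i - c) + k) * ((v i - c) + k)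
      ≡⟨ expand (sumSq v) (v i) k u (ℕtoℚ n) ⟩
    sumSq v + (k + k) * v i + k * k * (1ℚ - u) + (k * k * u) * (ℕtoℚ n * u - 1ℚ)
      ≡⟨ cong (λ t → sumSq v + (k + k) * v i + k * k * (1ℚ - u) + (k * k * u) * (t - 1ℚ)) (n*[1/n]≡1 n) ⟩
    sumSq v + (k + k) * v i + k * k * (1ℚ - u) + (k * k * u) * (1ℚ - 1ℚ)
      ≡⟨ drop-zero-term (sumSq v + (k + k) * v i + k * k * (1ℚ - u)) (k * k * u) ⟩
    sumSq v + (k + k) * v i + k * k * (1ℚ - u)
      ∎
    where
    open ≡-Reasoning
    u = (+ 1) / n
    v = dev f
    c = k * u
    mean-increment : mean f′ ≡ mean f + c
    mean-increment = begin
      sum f′ * u                          ≡⟨ cong (_* u) (sum-update i f′≡f) ⟩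
      ((sum f - f i) + f′ i) * u          ≡⟨ cong (λ t → ((sum f - f i) + t) * u) f′i≡fi+k ⟩
      ((sum f - f i) + (f i + k)) * u     ≡⟨ cancel (sum f) (f i) k u ⟩
      sum f * u + k * u                   ∎
      where
      cancel : ∀ s a k u → ((s - a) + (a + k)) * u ≡ s * u + k * u
      cancel = solve-∀ ℚ-ring
    dev-other : ∀ j → j ≢ i → dev f′ j ≡ v j - c
    dev-other j j≢i = trans (cong₂ _-_ (f′≡f j j≢i) mean-increment) (a-[m+c]≡[a-m]-c (f j) (mean f) c)
      where
      a-[m+c]≡[a-m]-c : ∀ a m c → a - (m + c) ≡ (a - m) - c
      a-[m+c]≡[a-m]-c = solve-∀ ℚ-ring
    dev-self : dev f′ i ≡ (v i - c) + k
    dev-self = trans (cong₂ _-_ f′i≡fi+k mean-increment) ([a+k]-[m+c]≡[[a-m]-c]+k (f i) (mean f) c k)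
      where
      [a+k]-[m+c]≡[[a-m]-c]+k : ∀ a m c k → (a + k) - (m + c) ≡ ((a - m) - c) + k
      [a+k]-[m+c]≡[[a-m]-c]+k = solve-∀ ℚ-ring
    expand : ∀ S V k u N →
      ((S + N * ((k * u) * (k * u))) - (V - k * u) * (V - k * u)) + ((V - k * u) + k) * ((V - k * u) + k)
        ≡ S + (k + k) * V + k * k * (1ℚ - u) + (k * k * u) * (N * u - 1ℚ)
    expand = solve-∀ ℚ-ring
    drop-zero-term : ∀ s a → s + a * (1ℚ - 1ℚ) ≡ s
    drop-zero-term = solve-∀ ℚ-ring

module _ {n : ℕ} .{{_ : NonZero n}} where

  loads : (Fin n → ℕ) → Fin n → ℚ
  loads x = ℕtoℚ ∘ x

  y≗dev : ∀ x j → y x j ≡ dev (loads x) j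
  y≗dev x j = cong (_-_ (ℕtoℚ (x j))) (begin
    (+ W x) / n                                        ≡⟨ a/n≡a*[1/n] (W x) n ⟩
    ℕtoℚ (W x) * ((+ 1) / n)                           ≡⟨ cong (_* ((+ 1) / n)) W≡sum ⟩
    sum (loads x) * ((+ 1) / n)                        ∎)
    where
    open ≡-Reasoning
    W≡sum : ℕtoℚ (W x) ≡ sum (loads x)
    W≡sum = begin
      ℕtoℚ (foldr ℕ._+_ 0 (map x (allFin n)))          ≡⟨ ℕtoℚ-foldr-+ (map x (allFin n)) ⟩
      foldr _+_ 0ℚ (map ℕtoℚ (map x (allFin n)))       ≡⟨ cong (foldr _+_ 0ℚ) (LP.map-∘ (allFin n)) ⟨
      Σ (loads x)                                      ≡⟨ Σ≡sum (loads x) ⟩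
      sum (loads x)                                    ∎

  sum-y≡0 : ∀ x → sum (y x) ≡ 0ℚ
  sum-y≡0 x = trans (sum-cong-≗ (y≗dev x)) (sum-dev≡0 (loads x))

  Υ≡sumSq-dev : ∀ x → Υ x ≡ sumSq (dev (loads x))
  Υ≡sumSq-dev x = trans (Σ≡sum (λ j → y x j * y x j)) (sum-cong-≗ λ j → cong₂ _*_ (y≗dev x j) (y≗dev x j))

  Δ≡sum∣y∣ : ∀ x → Δ x ≡ sum (λ j → ∣ y x j ∣)
  Δ≡sum∣y∣ x = Σ≡sum (λ j → ∣ y x j ∣)

  module _ (x : Fin n → ℕ) where

    overloaded : List (Fin n)
    overloaded = filter (λ j → 0ℚ ℚP.≤? y x j) (allFin n)

    p≤pPlus : ∀ p i → 0ℚ ≤ y x i → p i ≤ pPlus x p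
    p≤pPlus p i 0≤y = foldr-⊔-ub p 0ℚ (∈-filter⁺ (λ j → 0ℚ ℚP.≤? y x j) (∈-allFin i) 0≤y)

    pMinus≤p : ∀ p i → y x i < 0ℚ → pMinus x p ≤ p i
    pMinus≤p p i y<0 = foldr-⊓-lb p 1ℚ (∈-filter⁺ (λ j → y x j ℚP.<? 0ℚ) (∈-allFin i) y<0)

    δ≤1 : δ x ≤ 1ℚ
    δ≤1 = a/n≤1 n (ℕP.≤-trans (LP.length-filter (λ j → 0ℚ ℚP.≤? y x j) (allFin n))
                              (ℕP.≤-reflexive (LP.length-tabulate id)))

    0≤δ : 0ℚ ≤ δ x
    0≤δ = 0≤a/n (List.length overloaded) n

    0≤Δ : 0ℚ ≤ Δ x
    0≤Δ = subst (0ℚ ≤_) (sym (Δ≡sum∣y∣ x)) (sum-pres-0≤ (λ j → ℚP.0≤∣p∣ (y x j)))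

  module _ (w₊ w₋ : ℕ) (x : Fin n → ℕ) where

    weight-over : ∀ i → 0ℚ ≤ y x i → weight w₊ w₋ x i ≡ w₊
    weight-over i 0≤y with 0ℚ ℚP.≤? y x i
    ... | yes _   = refl
    ... | no  0≰y = contradiction 0≤y 0≰y

    weight-under : ∀ i → y x i < 0ℚ → weight w₊ w₋ x i ≡ w₋
    weight-under i y<0 with 0ℚ ℚP.≤? y x i
    ... | yes 0≤y = contradiction (ℚP.<-≤-trans y<0 0≤y) (ℚP.<-irrefl refl)
    ... | no  _   = refl

    weight≤w₋ : w₊ ℕ.≤ w₋ → ∀ i → weight w₊ w₋ x i ℕ.≤ w₋
    weight≤w₋ w₊≤w₋ i with 0ℚ ℚP.≤? y x i
    ... | yes _ = w₊≤w₋
    ... | no  _ = ℕP.≤-refl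

    step-other : ∀ i j → j ≢ i → step w₊ w₋ x i j ≡ x j
    step-other i j j≢i with i F.≟ j
    ... | yes i≡j = contradiction (sym i≡j) j≢i
    ... | no  _   = refl

    step-self : ∀ i → step w₊ w₋ x i i ≡ x i ℕ.+ weight w₊ w₋ x i
    step-self i with i F.≟ i
    ... | yes _   = refl
    ... | no  i≢i = contradiction refl i≢i

    Υ-step : ∀ i → let ω = ℕtoℚ (weight w₊ w₋ x i) in
      Υ (step w₊ w₋ x i) ≡ Υ x + (ω + ω) * y x i + ω * ω * (1ℚ - (+ 1) / n)
    Υ-step i = begin
      Υ (step w₊ w₋ x i)
        ≡⟨ Υ≡sumSq-dev (step w₊ w₋ x i) ⟩
      sumSq (dev (loads (step w₊ w₋ x i)))
        ≡⟨ sumSq-dev-increment (loads x) _ i ω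
             (λ j j≢i → cong ℕtoℚ (step-other i j j≢i))
             (trans (cong ℕtoℚ (step-self i)) (ℕtoℚ-homo-+ (x i) _)) ⟩
      sumSq (dev (loads x)) + (ω + ω) * dev (loads x) i + ω * ω * (1ℚ - (+ 1) / n)
        ≡⟨ cong₂ (λ s t → s + (ω + ω) * t + ω * ω * (1ℚ - (+ 1) / n)) (Υ≡sumSq-dev x) (y≗dev x i) ⟨
      Υ x + (ω + ω) * y x i + ω * ω * (1ℚ - (+ 1) / n)
        ∎
      where
      open ≡-Reasoning
      ω = ℕtoℚ (weight w₊ w₋ x i)

module _ {n : ℕ} .{{_ : NonZero n}} (w₊ w₋ : ℕ) (x : Fin n → ℕ) (p : Fin n → ℚ) where

  EΥnext-≤ : IsProb p → w₊ ℕ.≤ w₋ → ∀ A B →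
    (∀ i → 0ℚ ≤ y x i → p i * ℕtoℚ w₊ ≤ A) → (∀ i → y x i < 0ℚ → B ≤ p i * ℕtoℚ w₋) →
    EΥnext w₊ w₋ x p ≤ (Υ x - (B - A) * Δ x) + ℕtoℚ (w₋ ℕ.* w₋)
  EΥnext-≤ (0≤p , Σp≡1) w₊≤w₋ A B over under = begin
    EΥnext w₊ w₋ x p
      ≡⟨ Σ≡sum (λ i → p i * Υ (step w₊ w₋ x i)) ⟩
    sum (λ i → p i * Υ (step w₊ w₋ x i))
      ≡⟨ sum-cong-≗ per-bin ⟩
    sum (λ i → (Υ x * p i + (q i + q i) * y x i) + p i * r i)
      ≡⟨ ∑-distrib-+ (λ i → Υ x * p i + (q i + q i) * y x i) (λ i → p i * r i) ⟩
    sum (λ i → Υ x * p i + (q i + q i) * y x i) + sum (λ i → p i * r i)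
      ≡⟨ cong (_+ sum (λ i → p i * r i)) (∑-distrib-+ (λ i → Υ x * p i) (λ i → (q i + q i) * y x i)) ⟩
    (sum (λ i → Υ x * p i) + sum (λ i → (q i + q i) * y x i)) + sum (λ i → p i * r i)
      ≤⟨ ℚP.+-mono-≤ (ℚP.+-mono-≤ (ℚP.≤-reflexive constant-term) linear-term) quadratic-term ⟩
    (Υ x + (A - B) * Δ x) + ℕtoℚ (w₋ ℕ.* w₋)
      ≡⟨ rearrange (Υ x) A B (Δ x) _ ⟩
    (Υ x - (B - A) * Δ x) + ℕtoℚ (w₋ ℕ.* w₋)
      ∎
    where
    open ℚP.≤-Reasoning
    u = (+ 1) / n
    ω q r : Fin n → ℚ
    ω i = ℕtoℚ (weight w₊ w₋ x i)
    q i = p i * ω i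
    r i = ω i * ω i * (1ℚ - u)
    Σp≡1′ : sum p ≡ 1ℚ
    Σp≡1′ = trans (sym (Σ≡sum p)) Σp≡1

    per-bin : ∀ i → p i * Υ (step w₊ w₋ x i) ≡ (Υ x * p i + (q i + q i) * y x i) + p i * r i
    per-bin i = trans (cong (p i *_) (Υ-step w₊ w₋ x i)) (distribute (p i) (Υ x) (ω i) (y x i) u)
      where
      distribute : ∀ P U w Y u →
        P * (U + (w + w) * Y + w * w * (1ℚ - u)) ≡ (U * P + (P * w + P * w) * Y) + P * (w * w * (1ℚ - u))
      distribute = solve-∀ ℚ-ring

    constant-term : sum (λ i → Υ x * p i) ≡ Υ x
    constant-term = trans (sym (*-distribˡ-sum (Υ x) p)) (trans (cong (Υ x *_) Σp≡1′) (ℚP.*-identityʳ (Υ x)))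

    linear-term : sum (λ i → (q i + q i) * y x i) ≤ (A - B) * Δ x
    linear-term = subst (λ d → sum (λ i → (q i + q i) * y x i) ≤ (A - B) * d) (sym (Δ≡sum∣y∣ x))
      (sum-[q+q]*v≤[A-B]*sum∣v∣ q (y x) (sum-y≡0 x)
        (λ i 0≤y → subst (λ w → p i * ℕtoℚ w ≤ A) (sym (weight-over w₊ w₋ x i 0≤y)) (over i 0≤y))
        (λ i y<0 → subst (λ w → B ≤ p i * ℕtoℚ w) (sym (weight-under w₊ w₋ x i y<0)) (under i y<0)))

    quadratic-term : sum (λ i → p i * r i) ≤ ℕtoℚ (w₋ ℕ.* w₋)
    quadratic-term = weighted-average-≤ p r 0≤p Σp≡1′ λ i →
      subst (r i ≤_) (sym (ℕtoℚ-homo-* w₋ w₋))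
        (a*a*[1-u]≤b*b (0≤ℕtoℚ (weight w₊ w₋ x i)) (ℕtoℚ-mono-≤ (weight≤w₋ w₊ w₋ x w₊≤w₋ i)) (0≤a/n 1 n))

    rearrange : ∀ U A B D K → (U + (A - B) * D) + K ≡ (U - (B - A) * D) + K
    rearrange = solve-∀ ℚ-ring

0<ℕtoℚ[w*w] : ∀ {w} → 1 ℕ.≤ w → 0ℚ < ℕtoℚ (w ℕ.* w)
0<ℕtoℚ[w*w] 1≤w = ℚP.<-≤-trans 0<1 (ℕtoℚ-mono-≤ (ℕP.*-mono-≤ 1≤w 1≤w))

drift-p₊p₋ : (w₊ w₋ : ℕ) → 1 ℕ.≤ w₊ → w₊ ℕ.≤ w₋ →
      (n : ℕ) .{{_ : NonZero n}} (x : Fin n → ℕ) (p : Fin n → ℚ) →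
      IsProb p → P₂ x p →
      EΥnext w₊ w₋ x p
        ≤ (Υ x - (pMinus x p * ℕtoℚ w₋ - pPlus x p * ℕtoℚ w₊) * Δ x)
          + ℕtoℚ (4 ℕ.* (w₋ ℕ.* w₋))
drift-p₊p₋ w₊ w₋ _ w₊≤w₋ n x p prob _ = begin
  EΥnext w₊ w₋ x p
    ≤⟨ EΥnext-≤ w₊ w₋ x p prob w₊≤w₋ A B
         (λ i 0≤y → *-monoʳ-≤-0≤ (0≤ℕtoℚ w₊) (p≤pPlus x p i 0≤y))
         (λ i y<0 → *-monoʳ-≤-0≤ (0≤ℕtoℚ w₋) (pMinus≤p x p i y<0)) ⟩
  (Υ x - (B - A) * Δ x) + ℕtoℚ (w₋ ℕ.* w₋)
    ≤⟨ ℚP.+-monoʳ-≤ (Υ x - (B - A) * Δ x) (ℕtoℚ-mono-≤ (ℕP.m≤n*m (w₋ ℕ.* w₋) 4)) ⟩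
  (Υ x - (B - A) * Δ x) + ℕtoℚ (4 ℕ.* (w₋ ℕ.* w₋))
    ∎
  where
  open ℚP.≤-Reasoning
  A = pPlus x p * ℕtoℚ w₊
  B = pMinus x p * ℕtoℚ w₋

drift-P₃ : (w₊ w₋ : ℕ) → 1 ℕ.≤ w₊ → w₊ ℕ.≤ w₋ →
  (k₁ k₂ : ℚ) → 0ℚ ≤ k₁ → k₁ ≤ 1ℚ → 0ℚ ≤ k₂ → k₂ ≤ 1ℚ →
  (n : ℕ) .{{_ : NonZero n}} (x : Fin n → ℕ) (p : Fin n → ℚ) → IsProb p → P₃ k₁ k₂ x p →
  EΥnext w₊ w₋ x p ≤ (Υ x - ((k₁ * k₂) * ((+ 1) / n)) * Δ x) + ℕtoℚ (w₋ ℕ.* w₋)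
drift-P₃ w₊ w₋ 1≤w₊ w₊≤w₋ k₁ k₂ 0≤k₁ k₁≤1 0≤k₂ k₂≤1 n x p prob (_ , over , under) =
  ℚP.≤-trans
    (EΥnext-≤ w₊ w₋ x p prob w₊≤w₋ A B
      (λ i 0≤y → *-monoʳ-≤-0≤ (0≤ℕtoℚ w₊) (over i 0≤y))
      (λ i y<0 → *-monoʳ-≤-0≤ (0≤ℕtoℚ w₋) (under i y<0)))
    (drift-weaken (Υ x) _
      (P₃-gap (0≤a/n 1 n) (0≤δ x) (δ≤1 x) 0≤k₁ k₁≤1 0≤k₂ k₂≤1 (ℕtoℚ-mono-≤ 1≤w₊) (ℕtoℚ-mono-≤ w₊≤w₋))
      (0≤Δ x))
  where
  A = ((+ 1) / n - (k₁ * (1ℚ - δ x)) * ((+ 1) / n)) * ℕtoℚ w₊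
  B = ((+ 1) / n + (k₂ * δ x) * ((+ 1) / n)) * ℕtoℚ w₋

-- With w₊ < w₋, P₂ alone gives p₋w₋ − p₊w₊ ≥ (w₋ − w₊)/n ≥ 1/n.
drift-W₃ : (w₊ w₋ : ℕ) → w₊ ℕ.< w₋ →
  (n : ℕ) .{{_ : NonZero n}} (x : Fin n → ℕ) (p : Fin n → ℚ) → IsProb p → P₂ x p →
  EΥnext w₊ w₋ x p ≤ (Υ x - (1ℚ * ((+ 1) / n)) * Δ x) + ℕtoℚ (w₋ ℕ.* w₋)
drift-W₃ w₊ w₋ w₊<w₋ n x p prob (over , under) =
  ℚP.≤-trans
    (EΥnext-≤ w₊ w₋ x p prob (ℕP.<⇒≤ w₊<w₋) A B
      (λ i 0≤y → *-monoʳ-≤-0≤ (0≤ℕtoℚ w₊) (over i 0≤y))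
      (λ i y<0 → *-monoʳ-≤-0≤ (0≤ℕtoℚ w₋) (under i y<0)))
    (drift-weaken (Υ x) _
      (W₃-gap (0≤a/n 1 n) (subst (_≤ ℕtoℚ w₋) (ℕtoℚ-homo-+ 1 w₊) (ℕtoℚ-mono-≤ w₊<w₋)))
      (0≤Δ x))
  where
  A = (+ 1) / n * ℕtoℚ w₊
  B = (+ 1) / n * ℕtoℚ w₋

mainTheorem9 :
    ((w₊ w₋ : ℕ) → 1 ℕ.≤ w₊ → w₊ ℕ.≤ w₋ →
      (n : ℕ) .{{_ : NonZero n}} (x : Fin n → ℕ) (p : Fin n → ℚ) →
      IsProb p → P₂ x p →
      EΥnext w₊ w₋ x p
        ≤ (Υ x - (pMinus x p * ℕtoℚ w₋ - pPlus x p * ℕtoℚ w₊) * Δ x)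
          + ℕtoℚ (4 ℕ.* (w₋ ℕ.* w₋)))
    ×
    ((w₊ w₋ : ℕ) → 1 ℕ.≤ w₊ → w₊ ℕ.≤ w₋ →
      (k₁ k₂ : ℚ) → 0ℚ < k₁ → k₁ ≤ 1ℚ → 0ℚ < k₂ → k₂ ≤ 1ℚ →
      ∃₂ λ (c₁ c₂ : ℚ) → 0ℚ < c₁ × 0ℚ < c₂ ×
        ((n : ℕ) .{{_ : NonZero n}} (x : Fin n → ℕ) (p : Fin n → ℚ) →
          IsProb p → P₃ k₁ k₂ x p →
          EΥnext w₊ w₋ x p ≤ (Υ x - (c₁ * ((+ 1) / n)) * Δ x) + c₂))
    ×
    ((w₊ w₋ : ℕ) → 1 ℕ.≤ w₊ → w₊ ℕ.< w₋ →
      ∃₂ λ (c₁ c₂ : ℚ) → 0ℚ < c₁ × 0ℚ < c₂ ×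
        ((n : ℕ) .{{_ : NonZero n}} (x : Fin n → ℕ) (p : Fin n → ℚ) →
          IsProb p → P₂ x p → SortedMonotone x p →
          EΥnext w₊ w₋ x p ≤ (Υ x - (c₁ * ((+ 1) / n)) * Δ x) + c₂))
mainTheorem9 =
    drift-p₊p₋
  , (λ w₊ w₋ 1≤w₊ w₊≤w₋ k₁ k₂ 0<k₁ k₁≤1 0<k₂ k₂≤1 →
       k₁ * k₂ , ℕtoℚ (w₋ ℕ.* w₋) ,
       ℚP.positive⁻¹ _ {{ℚP.pos*pos⇒pos k₁ {{positive 0<k₁}} k₂ {{positive 0<k₂}}}} ,
       0<ℕtoℚ[w*w] (ℕP.≤-trans 1≤w₊ w₊≤w₋) ,
       drift-P₃ w₊ w₋ 1≤w₊ w₊≤w₋ k₁ k₂ (ℚP.<⇒≤ 0<k₁) k₁≤1 (ℚP.<⇒≤ 0<k₂) k₂≤1)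
  , (λ w₊ w₋ 1≤w₊ w₊<w₋ →
       1ℚ , ℕtoℚ (w₋ ℕ.* w₋) , 0<1 , 0<ℕtoℚ[w*w] (ℕP.≤-trans 1≤w₊ (ℕP.<⇒≤ w₊<w₋)) ,
       λ n x p prob P₂xp _ → drift-W₃ w₊ w₋ w₊<w₋ n x p prob P₂xp)
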